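{- For $n\ge1$ let $\delta_n:\mathfrak H\to\mathfrak H$ be the $\mathcal{C}$-linear derivation with $\delta_n(\mathbf a)=0$ and $\delta_n(\mathbf b)=\frac{(-1)^{n-1}}{n}(\mathbf b+1)\mathbf a^n\mathbf b$, and set $D^*_X=\sum_{n\ge1}X^n\delta_n$. Let $\phi(X)=\sum_{n\ge1}\frac{(-1)^{n-1}}{n}\mathbf a^n\mathbf b X^n$. Then for every $w\in\widehat{\mathfrak H^1}$, \[ D^*_X(w)=\phi(X)*_q w-\phi(X)\,w . \]
   Context: Let $\hbar$ be a formal variable, $\mathcal{C}=\mathbb{Q}[\hbar,\hbar^{ -1}]$, and $\mathfrak{H}=\mathcal{C}\langle \mathbf{a},\mathbf{b}\rangle$ the non-commutative polynomial ring over $\mathcal{C}$ in two indeterminates. Let $\widehat{\mathbb{N}}=\{\overline{1}\}\sqcup\mathbb{N}$, where $\overline{1}$ is a new symbol. Put $e_{\overline{1}}=\mathbf{a}\mathbf{b}$, $e_k=\mathbf{a}^{k-1}(\mathbf{a}+\hbar)\mathbf{b}$ for $k\ge 1$, and $e_{\overline n}=\mathbf a^n\mathbf b$. Let $\widehat{\mathfrak{H}^1}$ be the $\mathcal{C}$-subalgebra generated (freely) by $\{e_k\}_{k\in\widehat{\mathbb{N}}}$; it contains all $e_{\overline n}$. Stuffle product: let $\mathfrak{z}$ be the $\mathcal{C}$-span of $\{e_k\}_{k\in\widehat{\mathbb{N}}}$ and $\circ_q$ the symmetric $\mathcal{C}$-bilinear map with $e_{\overline1}\circ_q e_{\overline1}=e_2-\hbar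 e_{\overline1}$, $e_{\overline1}\circ_q e_k=e_{k+1}$, $e_k\circ_q e_l=e_{k+l}+\hbar e_{k+l-1}$ ($k,l\ge1$). The stuffle product $*_q$ is the $\mathcal{C}$-bilinear product on $\widehat{\mathfrak{H}^1}$ with $1*_q w=w*_q1=w$ and $(e_kw)*_q(e_lw')=e_k(w*_q e_lw')+e_l(e_kw*_q w')+(e_k\circ_q e_l)(w*_q w')$ for $k,l\in\widehat{\mathbb N}$, $w,w'\in\widehat{\mathfrak H^1}$. $X$ is a commuting formal variable; $*_q$ is extended $\mathcal C[[X]]$-linearly to $\widehat{\mathfrak H^1}[[X]]$, and $D^*_X$ acts on $\mathfrak H$ with values in $\mathfrak H[[X]]$. -}

module Defs where

open import Data.Nat as ℕ using (ℕ; zero; suc)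
open import Data.Integer as ℤ using (ℤ; +_; -1ℤ)
open import Data.Rational as ℚ using (ℚ; 0ℚ; 1ℚ)
open import Data.List using (List; []; _∷_; _++_; map; concatMap; foldr; upTo)
open import Relation.Nullary using (yes; no)
open import Relation.Binary.PropositionalEquality using (_≡_)
open import Relation.Binary using (DecidableEquality)
import Data.List.Properties as LP
import Data.Integer.Properties as ZP

-- Coefficient ring 𝒞 = ℚ[ħ,ħ⁻¹] and free 𝒞-modules.
-- A term  q ħ^k b  is stored as a triple (q , k , b); an element of the
-- free 𝒞-module with basis B is a finite formal sum (list) of terms.
-- Equality is equality of all coefficients (see _≈_ below).

record Term (B : Set) : Set where
  constructor term
  field
    coef : ℚ
    hexp : ℤ
    base : B
open Term public

FM : Set → Set
FM B = List (Term B)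

module _ {B : Set} where

  0M : FM B
  0M = []

  ⟦_⟧ : B → FM B
  ⟦ b ⟧ = term 1ℚ (+ 0) b ∷ []

  infixl 6 _⊕_ _⊖_
  _⊕_ : FM B → FM B → FM B
  x ⊕ y = x ++ y

  scal : ℚ → ℤ → FM B → FM B
  scal q k = map (λ t → term (q ℚ.* coef t) (k ℤ.+ hexp t) (base t))

  infixr 7 _·ℚ_
  _·ℚ_ : ℚ → FM B → FM B
  q ·ℚ x = scal q (+ 0) x

  ħ· : FM B → FM B
  ħ· x = scal 1ℚ (+ 1) x

  _⊖_ : FM B → FM B → FM B
  x ⊖ y = x ⊕ scal (ℚ.- 1ℚ) (+ 0) y

  ΣM : List (FM B) → FM B
  ΣM = foldr _⊕_ 0M

bilin : {A B C : Set} → (A → B → FM C) → FM A → FM B → FM C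
bilin f x y =
  concatMap (λ s → concatMap (λ t →
     scal (coef s ℚ.* coef t) (hexp s ℤ.+ hexp t) (f (base s) (base t))) y) x

lin : {A C : Set} → (A → FM C) → FM A → FM C
lin f = concatMap (λ s → scal (coef s) (hexp s) (f (base s)))

module _ {X : Set} where
  infixl 7 _·_
  _·_ : FM (List X) → FM (List X) → FM (List X)
  _·_ = bilin (λ u v → ⟦ u ++ v ⟧)

  1A : FM (List X)
  1A = ⟦ [] ⟧

  gen : X → FM (List X)
  gen x = ⟦ x ∷ [] ⟧

  pow : FM (List X) → ℕ → FM (List X)
  pow x zero = 1A
  pow x (suc n) = x · pow x n

data Letter : Set where
  ᵃ ᵇ : Letter

_≟L_ : DecidableEquality Letter
ᵃ ≟L ᵃ = yes Relation.Binary.PropositionalEquality.refl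
ᵃ ≟L ᵇ = no (λ ())
ᵇ ≟L ᵃ = no (λ ())
ᵇ ≟L ᵇ = yes Relation.Binary.PropositionalEquality.refl

𝔥 : Set
𝔥 = FM (List Letter)

𝐚 𝐛 : 𝔥
𝐚 = gen ᵃ
𝐛 = gen ᵇ

coeff : 𝔥 → ℤ → List Letter → ℚ
coeff [] k u = 0ℚ
coeff (t ∷ x) k u with hexp t ZP.≟ k | LP.≡-dec _≟L_ (base t) u
... | yes _ | yes _ = coef t ℚ.+ coeff x k u
... | _     | _     = coeff x k u

infix 4 _≈_
_≈_ : 𝔥 → 𝔥 → Set
x ≈ y = (k : ℤ) (u : List Letter) → coeff x k u ≡ coeff y k u

-- c n = (-1)^(n-1)/n, for n = suc m.
c : (m : ℕ) → ℚ
c m = (-1ℤ ℤ.^ m) ℚ./ suc m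

δgen : ℕ → Letter → 𝔥
δgen m ᵃ = 0M
δgen m ᵇ = c m ·ℚ ((𝐛 ⊕ 1A) · pow 𝐚 (suc m) · 𝐛)

δword : ℕ → List Letter → 𝔥
δword m [] = 0M
δword m (x ∷ u) = δgen m x · ⟦ u ⟧ ⊕ gen x · δword m u

-- δ_{suc m} : the 𝒞-linear derivation of 𝔥 determined by δgen m
δ : ℕ → 𝔥 → 𝔥
δ m = lin (δword m)

-- \hat{𝔥¹}: the free 𝒞-algebra on the letters e_k, k ∈ \hat{ℕ}.

data N̂ : Set where
  1̄ : N̂
  ix : ℕ → N̂        -- ix m is the natural number k = m + 1

H1 : Set
H1 = FM (List N̂)

e : N̂ → H1
e k = gen k

ιgen : N̂ → 𝔥
ιgen 1̄ = 𝐚 · 𝐛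
ιgen (ix m) = pow 𝐚 m · (𝐚 ⊕ ħ· 1A) · 𝐛

ιword : List N̂ → 𝔥
ιword [] = 1A
ιword (k ∷ u) = ιgen k · ιword u

ι : H1 → 𝔥
ι = lin ιword

-- e_{\bar n} as an element of \hat{𝔥¹} (n = suc m):
-- e_{\bar 1} = e_{\bar 1},  e_{\bar{n+1}} = e_{n+1} − ħ e_{\bar n}
-- (since e_{n+1} = 𝐚^{n+1}𝐛 + ħ 𝐚^n 𝐛).
ebar : ℕ → H1
ebar zero = e 1̄
ebar (suc m) = e (ix (suc m)) ⊖ ħ· (ebar m)

_∘q_ : N̂ → N̂ → H1
1̄ ∘q 1̄ = e (ix 1) ⊖ ħ· (e 1̄)
1̄ ∘q ix m = e (ix (suc m))
ix m ∘q 1̄ = e (ix (suc m))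
ix m ∘q ix n = e (ix (suc (m ℕ.+ n))) ⊕ ħ· (e (ix (m ℕ.+ n)))

_◃_ : N̂ → H1 → H1
k ◃ x = e k · x

_*w_ : List N̂ → List N̂ → H1
[] *w v = ⟦ v ⟧
(k ∷ w) *w v = go v
  where
  go : List N̂ → H1
  go [] = ⟦ k ∷ w ⟧
  go (l ∷ w') = k ◃ (w *w (l ∷ w')) ⊕ l ◃ go w' ⊕ (k ∘q l) · (w *w w')

infixl 7 _*q_
_*q_ : H1 → H1 → H1
_*q_ = bilin _*w_

PS : Set → Set
PS A = ℕ → A

const : {A : Set} → A → A → PS A
const z a zero = a
const z a (suc n) = z

cauchy : {A B C : Set} → (FM A → FM B → FM C) → PS (FM A) → PS (FM B) → PS (FM C)
cauchy op f g n = ΣM (map (λ i → op (f i) (g (n ℕ.∸ i))) (upTo (suc n)))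

cst : {B : Set} → FM B → PS (FM B)
cst x zero = x
cst x (suc n) = 0M

PSmap : {A B : Set} → (A → B) → PS A → PS B
PSmap f s n = f (s n)

infix 4 _≈ₚ_
_≈ₚ_ : PS 𝔥 → PS 𝔥 → Set
f ≈ₚ g = (n : ℕ) → f n ≈ g n

_⊖ₚ_ : PS 𝔥 → PS 𝔥 → PS 𝔥
(f ⊖ₚ g) n = f n ⊖ g n

D*X : 𝔥 → PS 𝔥
D*X w zero = 0M
D*X w (suc m) = δ m w

φ : PS 𝔥
φ zero = 0M
φ (suc m) = c m ·ℚ (pow 𝐚 (suc m) · 𝐛)

-- the same series, with coefficients in \hat{𝔥¹}[[X]] (𝐚^n𝐛 = e_{\bar n})
φ̂ : PS H1
φ̂ zero = 0M
φ̂ (suc m) = c m ·ℚ ebar m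

{-# OPTIONS --safe #-}
-- Both sides are 𝒞-linear in w, so it suffices to compare the coefficients of X^{m+1} for a
-- word w in the letters e_k, where the claim reads
--   δ_{m+1}(ι w) = c_m (ι(e_{\bar{m+1}} *q w) - 𝐚^{m+1}𝐛 · ι w).
-- Each ι(e_l) is a polynomial in 𝐚 and ħ followed by 𝐛; δ kills the polynomial, and
-- δ(𝐛) = c_m (𝐛 + 1) 𝐚^{m+1}𝐛 gives δ(ι e_l) = c_m (ι(e_l) 𝐚^{m+1}𝐛 + 𝐚^{m+1} ι(e_l)).
-- By Leibniz's rule, induction on w then reproduces the stuffle recursion for e_{\bar{m+1}} *q w,
-- in which e_{\bar{m+1}} ∘q e_l contributes exactly 𝐚^{m+1} ι(e_l).

module Submission where

open import Defs
open import Data.Nat using (ℕ; zero; suc; _+_; _∸_; _≤_; _<_; z≤n; s≤s)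
import Data.Nat.Properties as ℕP
open import Data.Integer as ℤ using (ℤ; +_)
import Data.Integer.Properties as ℤP
import Data.Integer.Tactic.RingSolver as ℤSolver
open import Data.Rational as ℚ using (ℚ; 0ℚ; 1ℚ)
import Data.Rational.Properties as ℚP
import Algebra.Properties.CommutativeSemigroup as CommutativeSemigroupProperties
open import Data.List using (List; []; _∷_; _++_; map; concatMap; length; applyUpTo)
import Data.List.Properties as ListP
open import Data.Sum using (_⊎_; inj₁; inj₂; [_,_])
open import Data.Empty using (⊥-elim)
open import Relation.Nullary using (yes; no; ¬_)
open import Relation.Nullary.Decidable using (dec⇒maybe)
open import Relation.Binary using (Setoid)
open import Algebra.Bundles using (CommutativeMonoid)
open import Relation.Binary.PropositionalEquality
import Relation.Binary.Reasoning.Setoid as SetoidReasoning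
open import Tactic.RingSolver using (solve-∀)
open import Tactic.RingSolver.Core.AlmostCommutativeRing using (AlmostCommutativeRing; fromCommutativeRing)

module ℚ+ = CommutativeSemigroupProperties (CommutativeMonoid.commutativeSemigroup ℚP.+-0-commutativeMonoid)

ℚ-ring : AlmostCommutativeRing _ _
ℚ-ring = fromCommutativeRing ℚP.+-*-commutativeRing (λ x → dec⇒maybe (0ℚ ℚ.≟ x))

-1ℚ : ℚ
-1ℚ = ℚ.- 1ℚ

-- The base is tested first, so that termCoeff reduces to 0ℚ whenever the bases differ.
termCoeff : Term (List Letter) → ℤ → List Letter → ℚ
termCoeff t k u with ListP.≡-dec _≟L_ (base t) u | hexp t ℤP.≟ k
... | yes _ | yes _ = coef t
... | yes _ | no _  = 0ℚ
... | no _  | _     = 0ℚ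

coeff-∷ : ∀ t x k u → coeff (t ∷ x) k u ≡ termCoeff t k u ℚ.+ coeff x k u
coeff-∷ t x k u with hexp t ℤP.≟ k | ListP.≡-dec _≟L_ (base t) u
... | yes _ | yes _ = refl
... | yes _ | no _  = sym (ℚP.+-identityˡ _)
... | no _  | yes _ = sym (ℚP.+-identityˡ _)
... | no _  | no _  = sym (ℚP.+-identityˡ _)

coeff-++ : ∀ (x y : 𝔥) k u → coeff (x ++ y) k u ≡ coeff x k u ℚ.+ coeff y k u
coeff-++ []      y k u = sym (ℚP.+-identityˡ _)
coeff-++ (t ∷ x) y k u = begin
  coeff (t ∷ x ++ y) k u                        ≡⟨ coeff-∷ t (x ++ y) k u ⟩
  termCoeff t k u ℚ.+ coeff (x ++ y) k u        ≡⟨ cong (termCoeff t k u ℚ.+_) (coeff-++ x y k u) ⟩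
  termCoeff t k u ℚ.+ (coeff x k u ℚ.+ coeff y k u) ≡⟨ sym (ℚP.+-assoc (termCoeff t k u) _ _) ⟩
  (termCoeff t k u ℚ.+ coeff x k u) ℚ.+ coeff y k u ≡⟨ cong (ℚ._+ coeff y k u) (sym (coeff-∷ t x k u)) ⟩
  coeff (t ∷ x) k u ℚ.+ coeff y k u             ∎
  where open ≡-Reasoning

termCoeff-scal : ∀ q j t k u →
  termCoeff (term (q ℚ.* coef t) (j ℤ.+ hexp t) (base t)) k u ≡ q ℚ.* termCoeff t (k ℤ.- j) u
termCoeff-scal q j t k u
  with ListP.≡-dec _≟L_ (base t) u | j ℤ.+ hexp t ℤP.≟ k | hexp t ℤP.≟ k ℤ.- j
... | no _  | _      | _     = sym (ℚP.*-zeroʳ q)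
... | yes _ | yes _  | yes _ = refl
... | yes _ | yes jh | no ¬h = ⊥-elim (¬h (trans (cancel j (hexp t)) (cong (ℤ._- j) jh)))
  where
  cancel : ∀ j h → h ≡ (j ℤ.+ h) ℤ.- j
  cancel = ℤSolver.solve-∀
... | yes _ | no ¬jh | yes h = ⊥-elim (¬jh (trans (cong (λ i → j ℤ.+ i) h) (shift j k)))
  where
  shift : ∀ j k → j ℤ.+ (k ℤ.- j) ≡ k
  shift = ℤSolver.solve-∀
... | yes _ | no _   | no _  = sym (ℚP.*-zeroʳ q)

coeff-scal : ∀ q j (x : 𝔥) k u → coeff (scal q j x) k u ≡ q ℚ.* coeff x (k ℤ.- j) u
coeff-scal q j []      k u = sym (ℚP.*-zeroʳ q)
coeff-scal q j (t ∷ x) k u = begin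
  coeff (scal q j (t ∷ x)) k u
    ≡⟨ coeff-∷ (term (q ℚ.* coef t) (j ℤ.+ hexp t) (base t)) (scal q j x) k u ⟩
  termCoeff (term (q ℚ.* coef t) (j ℤ.+ hexp t) (base t)) k u ℚ.+ coeff (scal q j x) k u
    ≡⟨ cong₂ ℚ._+_ (termCoeff-scal q j t k u) (coeff-scal q j x k u) ⟩
  q ℚ.* termCoeff t (k ℤ.- j) u ℚ.+ q ℚ.* coeff x (k ℤ.- j) u
    ≡⟨ sym (ℚP.*-distribˡ-+ q _ _) ⟩
  q ℚ.* (termCoeff t (k ℤ.- j) u ℚ.+ coeff x (k ℤ.- j) u)
    ≡⟨ cong (q ℚ.*_) (sym (coeff-∷ t x _ u)) ⟩
  q ℚ.* coeff (t ∷ x) (k ℤ.- j) u ∎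
  where open ≡-Reasoning

coeff-·ℚ : ∀ q (x : 𝔥) k u → coeff (q ·ℚ x) k u ≡ q ℚ.* coeff x k u
coeff-·ℚ q x k u = trans (coeff-scal q (+ 0) x k u) (cong (λ i → q ℚ.* coeff x i u) (ℤP.+-identityʳ k))

-- The equality _≈_ wrapped in a record, so that both sides can be inferred from a proof.
infix 4 _≋_
record _≋_ (x y : 𝔥) : Set where
  constructor ⟨_⟩
  field coeff-≡ : x ≈ y
open _≋_ public

≋-refl : {x : 𝔥} → x ≋ x
≋-refl = ⟨ (λ _ _ → refl) ⟩

≋-sym : {x y : 𝔥} → x ≋ y → y ≋ x
≋-sym p = ⟨ (λ k u → sym (coeff-≡ p k u)) ⟩

≋-trans : {x y z : 𝔥} → x ≋ y → y ≋ z → x ≋ z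
≋-trans p q = ⟨ (λ k u → trans (coeff-≡ p k u) (coeff-≡ q k u)) ⟩

≡⇒≋ : {x y : 𝔥} → x ≡ y → x ≋ y
≡⇒≋ refl = ≋-refl

≋-setoid : Setoid _ _
≋-setoid = record
  { Carrier = 𝔥 ; _≈_ = _≋_
  ; isEquivalence = record { refl = ≋-refl ; sym = ≋-sym ; trans = ≋-trans } }

module ≋-Reasoning = SetoidReasoning ≋-setoid

⊕-cong : {x x' y y' : 𝔥} → x ≋ x' → y ≋ y' → x ⊕ y ≋ x' ⊕ y'
⊕-cong {x} {x'} {y} {y'} p q = ⟨ (λ k u →
  trans (coeff-++ x y k u) (trans (cong₂ ℚ._+_ (coeff-≡ p k u) (coeff-≡ q k u)) (sym (coeff-++ x' y' k u)))) ⟩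

scal-cong : ∀ q j {x y : 𝔥} → x ≋ y → scal q j x ≋ scal q j y
scal-cong q j {x} {y} p = ⟨ (λ k u →
  trans (coeff-scal q j x k u) (trans (cong (q ℚ.*_) (coeff-≡ p (k ℤ.- j) u)) (sym (coeff-scal q j y k u)))) ⟩

-- The coefficients of lin g x are weighted sums over x; ≋ is transported through lin
-- by showing that every weighted sum over a formal sum with vanishing coefficients is 0.

weightedSum : {A : Set} → FM A → (ℤ → A → ℚ) → ℚ
weightedSum []      h = 0ℚ
weightedSum (t ∷ x) h = coef t ℚ.* h (hexp t) (base t) ℚ.+ weightedSum x h

coeff-lin : ∀ {A : Set} (g : A → 𝔥) (x : FM A) k u →
  coeff (lin g x) k u ≡ weightedSum x (λ j a → coeff (g a) (k ℤ.- j) u)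
coeff-lin g []      k u = refl
coeff-lin g (t ∷ x) k u = trans (coeff-++ (scal (coef t) (hexp t) (g (base t))) (lin g x) k u)
  (cong₂ ℚ._+_ (coeff-scal (coef t) (hexp t) (g (base t)) k u) (coeff-lin g x k u))

weightedSum-++ : ∀ {A : Set} (x y : FM A) h → weightedSum (x ++ y) h ≡ weightedSum x h ℚ.+ weightedSum y h
weightedSum-++ []      y h = sym (ℚP.+-identityˡ _)
weightedSum-++ (t ∷ x) y h =
  trans (cong (coef t ℚ.* h (hexp t) (base t) ℚ.+_) (weightedSum-++ x y h))
        (sym (ℚP.+-assoc (coef t ℚ.* h (hexp t) (base t)) _ _))

weightedSum-scal : ∀ {A : Set} q j (x : FM A) h →
  weightedSum (scal q j x) h ≡ q ℚ.* weightedSum x (λ i a → h (j ℤ.+ i) a)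
weightedSum-scal q j []      h = sym (ℚP.*-zeroʳ q)
weightedSum-scal q j (t ∷ x) h =
  trans (cong (q ℚ.* coef t ℚ.* h (j ℤ.+ hexp t) (base t) ℚ.+_) (weightedSum-scal q j x h))
        (factor q (coef t) (h (j ℤ.+ hexp t) (base t)) _)
  where
  factor : ∀ q c w s → q ℚ.* c ℚ.* w ℚ.+ q ℚ.* s ≡ q ℚ.* (c ℚ.* w ℚ.+ s)
  factor = solve-∀ ℚ-ring

weightedSum-cong : ∀ {A : Set} (x : FM A) {h h'} → (∀ i a → h i a ≡ h' i a) → weightedSum x h ≡ weightedSum x h'
weightedSum-cong []      p = refl
weightedSum-cong (t ∷ x) p = cong₂ ℚ._+_ (cong (coef t ℚ.*_) (p (hexp t) (base t))) (weightedSum-cong x p)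

dropKey : ℤ → List Letter → 𝔥 → 𝔥
dropKey k u [] = []
dropKey k u (t ∷ x) with hexp t ℤP.≟ k | ListP.≡-dec _≟L_ (base t) u
... | yes _ | yes _ = dropKey k u x
... | _     | _     = t ∷ dropKey k u x

weightedSum-∷-kept : ∀ k u t (x : 𝔥) h →
  weightedSum x h ≡ coeff x k u ℚ.* h k u ℚ.+ weightedSum (dropKey k u x) h →
  weightedSum (t ∷ x) h ≡ coeff x k u ℚ.* h k u ℚ.+ weightedSum (t ∷ dropKey k u x) h
weightedSum-∷-kept k u t x h eq = trans (cong (tₕ ℚ.+_) eq) (ℚ+.x∙yz≈y∙xz tₕ (coeff x k u ℚ.* h k u) _)
  where
  tₕ : ℚ
  tₕ = coef t ℚ.* h (hexp t) (base t)

weightedSum-dropKey : ∀ k u (x : 𝔥) h →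
  weightedSum x h ≡ coeff x k u ℚ.* h k u ℚ.+ weightedSum (dropKey k u x) h
weightedSum-dropKey k u []      h = sym (trans (cong (ℚ._+ 0ℚ) (ℚP.*-zeroˡ (h k u))) (ℚP.+-identityʳ 0ℚ))
weightedSum-dropKey k u (t ∷ x) h with hexp t ℤP.≟ k | ListP.≡-dec _≟L_ (base t) u
... | yes refl | yes refl = trans (cong (coef t ℚ.* h k u ℚ.+_) (weightedSum-dropKey k u x h))
                                  (collect (coef t) (h k u) (coeff x k u) _)
  where
  collect : ∀ c w d s → c ℚ.* w ℚ.+ (d ℚ.* w ℚ.+ s) ≡ (c ℚ.+ d) ℚ.* w ℚ.+ s
  collect = solve-∀ ℚ-ring
... | yes _ | no _  = weightedSum-∷-kept k u t x h (weightedSum-dropKey k u x h)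
... | no _  | yes _ = weightedSum-∷-kept k u t x h (weightedSum-dropKey k u x h)
... | no _  | no _  = weightedSum-∷-kept k u t x h (weightedSum-dropKey k u x h)

coeff-∷-cong : ∀ t {x y : 𝔥} {k u} → coeff x k u ≡ coeff y k u → coeff (t ∷ x) k u ≡ coeff (t ∷ y) k u
coeff-∷-cong t {x} {y} {k} {u} p =
  trans (coeff-∷ t x k u) (trans (cong (termCoeff t k u ℚ.+_) p) (sym (coeff-∷ t y k u)))

coeff-∷-otherKey : ∀ t (x : 𝔥) k u → ¬ hexp t ≡ k ⊎ ¬ base t ≡ u → coeff (t ∷ x) k u ≡ coeff x k u
coeff-∷-otherKey t x k u other with hexp t ℤP.≟ k | ListP.≡-dec _≟L_ (base t) u
... | yes p | yes q = ⊥-elim ([ (λ ¬p → ¬p p) , (λ ¬q → ¬q q) ] other)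
... | yes _ | no _  = refl
... | no _  | yes _ = refl
... | no _  | no _  = refl

coeff-dropKey-self : ∀ k u (x : 𝔥) → coeff (dropKey k u x) k u ≡ 0ℚ
coeff-dropKey-self k u [] = refl
coeff-dropKey-self k u (t ∷ x) with hexp t ℤP.≟ k | ListP.≡-dec _≟L_ (base t) u
... | yes _ | yes _ = coeff-dropKey-self k u x
... | yes _ | no q  = trans (coeff-∷-otherKey t (dropKey k u x) k u (inj₂ q)) (coeff-dropKey-self k u x)
... | no p  | yes _ = trans (coeff-∷-otherKey t (dropKey k u x) k u (inj₁ p)) (coeff-dropKey-self k u x)
... | no p  | no _  = trans (coeff-∷-otherKey t (dropKey k u x) k u (inj₁ p)) (coeff-dropKey-self k u x)

coeff-dropKey-other : ∀ k u (x : 𝔥) k' u' → ¬ k' ≡ k ⊎ ¬ u' ≡ u → coeff (dropKey k u x) k' u' ≡ coeff x k' u'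
coeff-dropKey-other k u []      k' u' other = refl
coeff-dropKey-other k u (t ∷ x) k' u' other with hexp t ℤP.≟ k | ListP.≡-dec _≟L_ (base t) u
... | yes refl | yes refl =
  trans (coeff-dropKey-other k u x k' u' other)
        (sym (coeff-∷-otherKey t x k' u' ([ (λ ¬p → inj₁ (λ p → ¬p (sym p)))
                                            , (λ ¬q → inj₂ (λ q → ¬q (sym q))) ] other)))
... | yes _ | no _  = coeff-∷-cong t (coeff-dropKey-other k u x k' u' other)
... | no _  | yes _ = coeff-∷-cong t (coeff-dropKey-other k u x k' u' other)
... | no _  | no _  = coeff-∷-cong t (coeff-dropKey-other k u x k' u' other)

length-dropKey : ∀ k u (x : 𝔥) → length (dropKey k u x) ≤ length x
length-dropKey k u [] = z≤n
length-dropKey k u (t ∷ x) with hexp t ℤP.≟ k | ListP.≡-dec _≟L_ (base t) u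
... | yes _ | yes _ = ℕP.m≤n⇒m≤1+n (length-dropKey k u x)
... | yes _ | no _  = s≤s (length-dropKey k u x)
... | no _  | yes _ = s≤s (length-dropKey k u x)
... | no _  | no _  = s≤s (length-dropKey k u x)

dropKey-∷-self : ∀ t (x : 𝔥) → dropKey (hexp t) (base t) (t ∷ x) ≡ dropKey (hexp t) (base t) x
dropKey-∷-self t x with hexp t ℤP.≟ hexp t | ListP.≡-dec _≟L_ (base t) (base t)
... | yes _ | yes _ = refl
... | yes _ | no ¬q = ⊥-elim (¬q refl)
... | no ¬p | _     = ⊥-elim (¬p refl)

weightedSum-vanishing : ∀ n (z : 𝔥) → length z ≤ n → (∀ k u → coeff z k u ≡ 0ℚ) → ∀ h → weightedSum z h ≡ 0ℚ
weightedSum-vanishing n       []      _           _   h = refl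
weightedSum-vanishing (suc n) (t ∷ z) (s≤s |z|≤n) z≈0 h = begin
  weightedSum (t ∷ z) h
    ≡⟨ weightedSum-dropKey k u (t ∷ z) h ⟩
  coeff (t ∷ z) k u ℚ.* h k u ℚ.+ weightedSum (dropKey k u (t ∷ z)) h
    ≡⟨ cong₂ (λ a x → a ℚ.* h k u ℚ.+ weightedSum x h) (z≈0 k u) (dropKey-∷-self t z) ⟩
  0ℚ ℚ.* h k u ℚ.+ weightedSum (dropKey k u z) h
    ≡⟨ trans (cong (ℚ._+ weightedSum (dropKey k u z) h) (ℚP.*-zeroˡ (h k u))) (ℚP.+-identityˡ _) ⟩
  weightedSum (dropKey k u z) h
    ≡⟨ weightedSum-vanishing n (dropKey k u z) (ℕP.≤-trans (length-dropKey k u z) |z|≤n) dropped≈0 h ⟩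
  0ℚ ∎
  where
  open ≡-Reasoning
  k : ℤ
  k = hexp t
  u : List Letter
  u = base t
  other≈0 : ∀ k' u' → ¬ k' ≡ k ⊎ ¬ u' ≡ u → coeff (dropKey k u z) k' u' ≡ 0ℚ
  other≈0 k' u' other = begin
    coeff (dropKey k u z) k' u'       ≡⟨ cong (λ x → coeff x k' u') (sym (dropKey-∷-self t z)) ⟩
    coeff (dropKey k u (t ∷ z)) k' u' ≡⟨ coeff-dropKey-other k u (t ∷ z) k' u' other ⟩
    coeff (t ∷ z) k' u'               ≡⟨ z≈0 k' u' ⟩
    0ℚ                                ∎
  dropped≈0 : ∀ k' u' → coeff (dropKey k u z) k' u' ≡ 0ℚ
  dropped≈0 k' u' with k' ℤP.≟ k | ListP.≡-dec _≟L_ u' u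
  ... | yes refl | yes refl = coeff-dropKey-self k u z
  ... | yes _    | no ¬q    = other≈0 k' u' (inj₂ ¬q)
  ... | no ¬p    | _        = other≈0 k' u' (inj₁ ¬p)

weightedSum-≋ : ∀ {x y : 𝔥} → x ≋ y → ∀ h → weightedSum x h ≡ weightedSum y h
weightedSum-≋ {x} {y} x≋y h = begin
  weightedSum x h                                           ≡⟨ split (weightedSum x h) (weightedSum y h) ⟩
  (weightedSum x h ℚ.+ -1ℚ ℚ.* weightedSum y h) ℚ.+ weightedSum y h
    ≡⟨ cong (ℚ._+ weightedSum y h) (sym weightedSum-⊖) ⟩
  weightedSum (x ⊖ y) h ℚ.+ weightedSum y h
    ≡⟨ cong (ℚ._+ weightedSum y h) (weightedSum-vanishing _ (x ⊖ y) ℕP.≤-refl x⊖y≈0 h) ⟩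
  0ℚ ℚ.+ weightedSum y h                                    ≡⟨ ℚP.+-identityˡ _ ⟩
  weightedSum y h                                           ∎
  where
  open ≡-Reasoning
  split : ∀ a b → a ≡ (a ℚ.+ -1ℚ ℚ.* b) ℚ.+ b
  split = solve-∀ ℚ-ring
  cancel : ∀ a → a ℚ.+ -1ℚ ℚ.* a ≡ 0ℚ
  cancel = solve-∀ ℚ-ring
  weightedSum-⊖ : weightedSum (x ⊖ y) h ≡ weightedSum x h ℚ.+ -1ℚ ℚ.* weightedSum y h
  weightedSum-⊖ = trans (weightedSum-++ x _ h) (cong (weightedSum x h ℚ.+_)
    (trans (weightedSum-scal -1ℚ (+ 0) y h)
      (cong (-1ℚ ℚ.*_) (weightedSum-cong y (λ i a → cong (λ j → h j a) (ℤP.+-identityˡ i))))))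
  x⊖y≈0 : ∀ k u → coeff (x ⊖ y) k u ≡ 0ℚ
  x⊖y≈0 k u = trans (coeff-++ x _ k u)
    (trans (cong₂ ℚ._+_ (coeff-≡ x≋y k u) (coeff-·ℚ -1ℚ y k u)) (cancel (coeff y k u)))

lin-cong : ∀ (g : List Letter → 𝔥) {x y : 𝔥} → x ≋ y → lin g x ≋ lin g y
lin-cong g {x} {y} x≋y = ⟨ (λ k u → trans (coeff-lin g x k u)
  (trans (weightedSum-≋ x≋y (λ j a → coeff (g a) (k ℤ.- j) u)) (sym (coeff-lin g y k u)))) ⟩

scal-scal : ∀ q j q' j' {q″ j″} → q ℚ.* q' ≡ q″ → j ℤ.+ j' ≡ j″ → (z : 𝔥) →
  scal q j (scal q' j' z) ≋ scal q″ j″ z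
scal-scal q j q' j' refl refl z = ⟨ (λ k u → begin
  coeff (scal q j (scal q' j' z)) k u             ≡⟨ coeff-scal q j (scal q' j' z) k u ⟩
  q ℚ.* coeff (scal q' j' z) (k ℤ.- j) u          ≡⟨ cong (q ℚ.*_) (coeff-scal q' j' z _ u) ⟩
  q ℚ.* (q' ℚ.* coeff z ((k ℤ.- j) ℤ.- j') u)     ≡⟨ sym (ℚP.*-assoc q q' _) ⟩
  (q ℚ.* q') ℚ.* coeff z ((k ℤ.- j) ℤ.- j') u     ≡⟨ cong (λ i → (q ℚ.* q') ℚ.* coeff z i u) (sym (sub-+ k j j')) ⟩
  (q ℚ.* q') ℚ.* coeff z (k ℤ.- (j ℤ.+ j')) u     ≡⟨ sym (coeff-scal (q ℚ.* q') (j ℤ.+ j') z k u) ⟩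
  coeff (scal (q ℚ.* q') (j ℤ.+ j') z) k u        ∎) ⟩
  where
  open ≡-Reasoning
  sub-+ : ∀ k j j' → k ℤ.- (j ℤ.+ j') ≡ (k ℤ.- j) ℤ.- j'
  sub-+ = ℤSolver.solve-∀

⊕-assoc : (x y z : 𝔥) → (x ⊕ y) ⊕ z ≋ x ⊕ (y ⊕ z)
⊕-assoc x y z = ≡⇒≋ (ListP.++-assoc x y z)

⊕-identityʳ : (x : 𝔥) → x ⊕ [] ≋ x
⊕-identityʳ x = ≡⇒≋ (ListP.++-identityʳ x)

⊕-interchange : (a b c d : 𝔥) → (a ⊕ b) ⊕ (c ⊕ d) ≋ (a ⊕ c) ⊕ (b ⊕ d)
⊕-interchange a b c d = ⟨ (λ k u → begin
  coeff ((a ⊕ b) ⊕ (c ⊕ d)) k u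
    ≡⟨ trans (coeff-++ (a ⊕ b) _ k u) (cong₂ ℚ._+_ (coeff-++ a b k u) (coeff-++ c d k u)) ⟩
  (coeff a k u ℚ.+ coeff b k u) ℚ.+ (coeff c k u ℚ.+ coeff d k u)
    ≡⟨ ℚ+.interchange (coeff a k u) (coeff b k u) (coeff c k u) (coeff d k u) ⟩
  (coeff a k u ℚ.+ coeff c k u) ℚ.+ (coeff b k u ℚ.+ coeff d k u)
    ≡⟨ sym (trans (coeff-++ (a ⊕ c) _ k u) (cong₂ ℚ._+_ (coeff-++ a c k u) (coeff-++ b d k u))) ⟩
  coeff ((a ⊕ c) ⊕ (b ⊕ d)) k u ∎) ⟩
  where open ≡-Reasoning

concatMap-cong : ∀ {A : Set} {F G : A → 𝔥} → (∀ a → F a ≋ G a) → (x : List A) → concatMap F x ≋ concatMap G x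
concatMap-cong F≋G []      = ≋-refl
concatMap-cong F≋G (s ∷ x) = ⊕-cong (F≋G s) (concatMap-cong F≋G x)

concatMap-⊕ : ∀ {A : Set} (F G : A → 𝔥) (x : List A) →
  concatMap (λ s → F s ⊕ G s) x ≋ concatMap F x ⊕ concatMap G x
concatMap-⊕ F G []      = ≋-refl
concatMap-⊕ F G (s ∷ x) = ≋-trans (⊕-cong (≋-refl {F s ⊕ G s}) (concatMap-⊕ F G x)) (⊕-interchange (F s) (G s) _ _)

record IsLinear {A : Set} (f : FM A → 𝔥) : Set where
  field
    linear-[] : f [] ≋ []
    linear-∷  : ∀ t x → f (t ∷ x) ≋ scal (coef t) (hexp t) (f ⟦ base t ⟧) ⊕ f x
open IsLinear public

module _ {A : Set} {f : FM A → 𝔥} (L : IsLinear f) where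

  linear-⊕ : (x y : FM A) → f (x ⊕ y) ≋ f x ⊕ f y
  linear-⊕ []      y = ⊕-cong (≋-sym (linear-[] L)) (≋-refl {f y})
  linear-⊕ (t ∷ x) y = let open ≋-Reasoning in begin
    f (t ∷ x ⊕ y)                                     ≈⟨ linear-∷ L t (x ⊕ y) ⟩
    scal (coef t) (hexp t) (f ⟦ base t ⟧) ⊕ f (x ⊕ y)  ≈⟨ ⊕-cong ≋-refl (linear-⊕ x y) ⟩
    scal (coef t) (hexp t) (f ⟦ base t ⟧) ⊕ (f x ⊕ f y) ≈⟨ ≋-sym (⊕-assoc _ (f x) (f y)) ⟩
    (scal (coef t) (hexp t) (f ⟦ base t ⟧) ⊕ f x) ⊕ f y ≈⟨ ⊕-cong (≋-sym (linear-∷ L t x)) ≋-refl ⟩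
    f (t ∷ x) ⊕ f y                                   ∎

  linear-scal : ∀ q j (x : FM A) → f (scal q j x) ≋ scal q j (f x)
  linear-scal q j []      = ≋-trans (linear-[] L) (≋-sym (scal-cong q j (linear-[] L)))
  linear-scal q j (t ∷ x) = let open ≋-Reasoning in begin
    f (scal q j (t ∷ x))
      ≈⟨ linear-∷ L _ (scal q j x) ⟩
    scal (q ℚ.* coef t) (j ℤ.+ hexp t) (f ⟦ base t ⟧) ⊕ f (scal q j x)
      ≈⟨ ⊕-cong (≋-sym (scal-scal q j (coef t) (hexp t) refl refl (f ⟦ base t ⟧))) (linear-scal q j x) ⟩
    scal q j (scal (coef t) (hexp t) (f ⟦ base t ⟧)) ⊕ scal q j (f x)
      ≡⟨ sym (ListP.map-++ _ (scal (coef t) (hexp t) (f ⟦ base t ⟧)) (f x)) ⟩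
    scal q j (scal (coef t) (hexp t) (f ⟦ base t ⟧) ⊕ f x)
      ≈⟨ scal-cong q j (≋-sym (linear-∷ L t x)) ⟩
    scal q j (f (t ∷ x)) ∎

  linear-≋-lin : (x : FM A) → f x ≋ lin (λ v → f ⟦ v ⟧) x
  linear-≋-lin []      = linear-[] L
  linear-≋-lin (t ∷ x) = ≋-trans (linear-∷ L t x) (⊕-cong ≋-refl (linear-≋-lin x))

  linear-lin : ∀ {B : Set} (g : B → FM A) (x : FM B) → f (lin g x) ≋ lin (λ b → f (g b)) x
  linear-lin g []      = linear-[] L
  linear-lin g (t ∷ x) = ≋-trans (linear-⊕ (scal (coef t) (hexp t) (g (base t))) (lin g x))
    (⊕-cong (linear-scal (coef t) (hexp t) (g (base t))) (linear-lin g x))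

  linear-concatMap : ∀ {B : Set} (F : B → FM A) (x : List B) → f (concatMap F x) ≋ concatMap (λ b → f (F b)) x
  linear-concatMap F []      = linear-[] L
  linear-concatMap F (s ∷ x) = ≋-trans (linear-⊕ (F s) (concatMap F x)) (⊕-cong ≋-refl (linear-concatMap F x))

lin-pointwise : ∀ {A : Set} {g g' : A → 𝔥} → (∀ a → g a ≋ g' a) → (x : FM A) → lin g x ≋ lin g' x
lin-pointwise g≋g' []      = ≋-refl
lin-pointwise g≋g' (t ∷ x) = ⊕-cong (scal-cong (coef t) (hexp t) (g≋g' (base t))) (lin-pointwise g≋g' x)

lin-⟦⟧ : ∀ {A : Set} (g : A → 𝔥) (a : A) → lin g ⟦ a ⟧ ≋ g a
lin-⟦⟧ g a = ≋-trans (⊕-identityʳ _) ⟨ (λ k u → trans (coeff-·ℚ 1ℚ (g a) k u) (ℚP.*-identityˡ _)) ⟩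

lin-isLinear : ∀ {A : Set} (g : A → 𝔥) → IsLinear (lin g)
lin-isLinear g = record
  { linear-[] = ≋-refl
  ; linear-∷  = λ t x → ⊕-cong (scal-cong (coef t) (hexp t) (≋-sym (lin-⟦⟧ g (base t)))) ≋-refl }

linear-ext : ∀ {A : Set} {f f' : FM A → 𝔥} → IsLinear f → IsLinear f' →
  (∀ v → f ⟦ v ⟧ ≋ f' ⟦ v ⟧) → ∀ x → f x ≋ f' x
linear-ext L L' on-basis x =
  ≋-trans (linear-≋-lin L x) (≋-trans (lin-pointwise on-basis x) (≋-sym (linear-≋-lin L' x)))

linear-cong : {f : 𝔥 → 𝔥} → IsLinear f → {x y : 𝔥} → x ≋ y → f x ≋ f y
linear-cong {f} L {x} {y} x≋y =
  ≋-trans (linear-≋-lin L x) (≋-trans (lin-cong (λ v → f ⟦ v ⟧) x≋y) (≋-sym (linear-≋-lin L y)))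

∘-isLinear : ∀ {A : Set} {g : 𝔥 → 𝔥} {f : FM A → 𝔥} → IsLinear g → IsLinear f → IsLinear (λ x → g (f x))
∘-isLinear {g = g} {f} G F = record
  { linear-[] = ≋-trans (linear-cong G (linear-[] F)) (linear-[] G)
  ; linear-∷  = λ t x → ≋-trans (linear-cong G (linear-∷ F t x))
      (≋-trans (linear-⊕ G _ (f x)) (⊕-cong (linear-scal G (coef t) (hexp t) (f ⟦ base t ⟧)) ≋-refl)) }

⊕-isLinear : ∀ {A : Set} {f f' : FM A → 𝔥} → IsLinear f → IsLinear f' → IsLinear (λ x → f x ⊕ f' x)
⊕-isLinear {f = f} {f'} L L' = record
  { linear-[] = ⊕-cong (linear-[] L) (linear-[] L')
  ; linear-∷  = λ t x → ≋-trans (⊕-cong (linear-∷ L t x) (linear-∷ L' t x))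
      (≋-trans (⊕-interchange (scal (coef t) (hexp t) (f ⟦ base t ⟧)) (f x)
                              (scal (coef t) (hexp t) (f' ⟦ base t ⟧)) (f' x))
        (⊕-cong (≡⇒≋ (sym (ListP.map-++ _ (f ⟦ base t ⟧) (f' ⟦ base t ⟧)))) (≋-refl {f x ⊕ f' x}))) }

scal-isLinear : ∀ q j → IsLinear (scal q j)
scal-isLinear q j = record
  { linear-[] = ≋-refl
  ; linear-∷  = λ t x → ⊕-cong {x = term (q ℚ.* coef t) (j ℤ.+ hexp t) (base t) ∷ []}
      (≡⇒≋ (cong₂ (λ a i → term a i (base t) ∷ []) (reassoc q (coef t)) (shift j (hexp t)))) ≋-refl }
  where
  reassoc : ∀ q c → q ℚ.* c ≡ c ℚ.* (q ℚ.* 1ℚ)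
  reassoc = solve-∀ ℚ-ring
  shift : ∀ j h → j ℤ.+ h ≡ h ℤ.+ (j ℤ.+ + 0)
  shift = ℤSolver.solve-∀

isLinear-resp : ∀ {A : Set} {f f' : FM A → 𝔥} → (∀ x → f x ≋ f' x) → IsLinear f' → IsLinear f
isLinear-resp f≋f' L = record
  { linear-[] = ≋-trans (f≋f' []) (linear-[] L)
  ; linear-∷  = λ t x → ≋-trans (f≋f' (t ∷ x))
      (≋-trans (linear-∷ L t x)
        (⊕-cong (scal-cong (coef t) (hexp t) (≋-sym (f≋f' ⟦ base t ⟧))) (≋-sym (f≋f' x)))) }

bilinʳ-isLinear : ∀ {A B : Set} (f : A → B → 𝔥) (x : FM A) → IsLinear (bilin f x)
bilinʳ-isLinear f x = record { linear-[] = bilin-[] x ; linear-∷ = bilin-∷ }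
  where
  bilin-[] : ∀ x → bilin f x [] ≋ []
  bilin-[] []      = ≋-refl
  bilin-[] (s ∷ x) = bilin-[] x
  rescale : ∀ t s → scal (coef t) (hexp t) (scal (coef s ℚ.* 1ℚ) (hexp s ℤ.+ + 0) (f (base s) (base t)) ⊕ [])
                    ≋ scal (coef s ℚ.* coef t) (hexp s ℤ.+ hexp t) (f (base s) (base t))
  rescale t s = ≋-trans (≡⇒≋ (cong (scal (coef t) (hexp t)) (ListP.++-identityʳ _)))
    (scal-scal (coef t) (hexp t) (coef s ℚ.* 1ℚ) (hexp s ℤ.+ + 0)
      (trans (ℚP.*-comm (coef t) _) (cong (ℚ._* coef t) (ℚP.*-identityʳ (coef s))))
      (trans (ℤP.+-comm (hexp t) _) (cong (ℤ._+ hexp t) (ℤP.+-identityʳ (hexp s)))) _)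
  bilin-∷ : ∀ t y → bilin f x (t ∷ y) ≋ scal (coef t) (hexp t) (bilin f x ⟦ base t ⟧) ⊕ bilin f x y
  bilin-∷ t y = ≋-trans (concatMap-⊕ _ _ x)
    (⊕-cong (≋-sym (≋-trans (≡⇒≋ (ListP.map-concatMap _ _ x)) (concatMap-cong (rescale t) x))) ≋-refl)

bilinˡ-isLinear : ∀ {A B : Set} (f : A → B → 𝔥) (y : FM B) → IsLinear (λ x → bilin f x y)
bilinˡ-isLinear f y = record { linear-[] = ≋-refl ; linear-∷ = bilin-∷ }
  where
  rescale : ∀ t s → scal (coef t) (hexp t) (scal (1ℚ ℚ.* coef s) (+ 0 ℤ.+ hexp s) (f (base t) (base s)))
                    ≋ scal (coef t ℚ.* coef s) (hexp t ℤ.+ hexp s) (f (base t) (base s))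
  rescale t s = scal-scal (coef t) (hexp t) (1ℚ ℚ.* coef s) (+ 0 ℤ.+ hexp s)
    (cong (coef t ℚ.*_) (ℚP.*-identityˡ (coef s))) (cong (λ i → hexp t ℤ.+ i) (ℤP.+-identityˡ (hexp s))) _
  bilin-∷ : ∀ t x → bilin f (t ∷ x) y ≋ scal (coef t) (hexp t) (bilin f ⟦ base t ⟧ y) ⊕ bilin f x y
  bilin-∷ t x = ⊕-cong (≋-sym (≋-trans (≡⇒≋ (cong (scal (coef t) (hexp t)) (ListP.++-identityʳ _)))
    (≋-trans (≡⇒≋ (ListP.map-concatMap _ _ y)) (concatMap-cong (rescale t) y)))) ≋-refl

lin-bilin : ∀ {A B C : Set} (g : C → 𝔥) (f : A → B → FM C) (x : FM A) (y : FM B) →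
  lin g (bilin f x y) ≋ bilin (λ a b → lin g (f a b)) x y
lin-bilin {A} {B} {C} g f x y = ≋-trans (linear-concatMap G (λ s → concatMap (term-product s) y) x)
  (concatMap-cong (λ s → ≋-trans (linear-concatMap G (term-product s) y)
    (concatMap-cong (λ t → linear-scal G (coef s ℚ.* coef t) (hexp s ℤ.+ hexp t) (f (base s) (base t))) y)) x)
  where
  G : IsLinear (lin g)
  G = lin-isLinear g
  term-product : Term A → Term B → FM C
  term-product s t = scal (coef s ℚ.* coef t) (hexp s ℤ.+ hexp t) (f (base s) (base t))

lin-bilinˡ-isLinear : ∀ {A B C : Set} (g : C → 𝔥) (f : A → B → FM C) (y : FM B) →
  IsLinear (λ x → lin g (bilin f x y))
lin-bilinˡ-isLinear g f y = isLinear-resp (λ x → lin-bilin g f x y) (bilinˡ-isLinear (λ a b → lin g (f a b)) y)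

lin-bilinʳ-isLinear : ∀ {A B C : Set} (g : C → 𝔥) (f : A → B → FM C) (x : FM A) →
  IsLinear (λ y → lin g (bilin f x y))
lin-bilinʳ-isLinear g f x = isLinear-resp (lin-bilin g f x) (bilinʳ-isLinear (λ a b → lin g (f a b)) x)

bilin-⟦⟧ : ∀ {A B : Set} (f : A → B → 𝔥) a b → bilin f ⟦ a ⟧ ⟦ b ⟧ ≋ f a b
bilin-⟦⟧ f a b = ≋-trans (≡⇒≋ (trans (ListP.++-identityʳ _) (ListP.++-identityʳ _)))
  ⟨ (λ k u → trans (coeff-·ℚ 1ℚ (f a b) k u) (ℚP.*-identityˡ _)) ⟩

-- Identities between linear combinations are proved coefficientwise by the ring solver.

infixl 6 _⊞_
infixr 7 _⊛_
data LinExpr (B : Set) : Set where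
  atom : FM B → LinExpr B
  _⊞_  : LinExpr B → LinExpr B → LinExpr B
  _⊛_  : ℚ → LinExpr B → LinExpr B
  ħ⊛   : LinExpr B → LinExpr B

⟦_⟧ᴸ : {B : Set} → LinExpr B → FM B
⟦ atom x ⟧ᴸ = x
⟦ e ⊞ f  ⟧ᴸ = ⟦ e ⟧ᴸ ⊕ ⟦ f ⟧ᴸ
⟦ q ⊛ e  ⟧ᴸ = q ·ℚ ⟦ e ⟧ᴸ
⟦ ħ⊛ e   ⟧ᴸ = ħ· ⟦ e ⟧ᴸ

coeffᴸ : LinExpr (List Letter) → ℤ → List Letter → ℚ
coeffᴸ (atom x) k u = coeff x k u
coeffᴸ (e ⊞ f)  k u = coeffᴸ e k u ℚ.+ coeffᴸ f k u
coeffᴸ (q ⊛ e)  k u = q ℚ.* coeffᴸ e k u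
coeffᴸ (ħ⊛ e)   k u = coeffᴸ e (k ℤ.- + 1) u

coeff-⟦⟧ᴸ : ∀ e k u → coeff ⟦ e ⟧ᴸ k u ≡ coeffᴸ e k u
coeff-⟦⟧ᴸ (atom x) k u = refl
coeff-⟦⟧ᴸ (e ⊞ f)  k u = trans (coeff-++ ⟦ e ⟧ᴸ ⟦ f ⟧ᴸ k u) (cong₂ ℚ._+_ (coeff-⟦⟧ᴸ e k u) (coeff-⟦⟧ᴸ f k u))
coeff-⟦⟧ᴸ (q ⊛ e)  k u = trans (coeff-·ℚ q ⟦ e ⟧ᴸ k u) (cong (q ℚ.*_) (coeff-⟦⟧ᴸ e k u))
coeff-⟦⟧ᴸ (ħ⊛ e)   k u =
  trans (coeff-scal 1ℚ (+ 1) ⟦ e ⟧ᴸ k u) (trans (ℚP.*-identityˡ _) (coeff-⟦⟧ᴸ e (k ℤ.- + 1) u))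

≋-byCoeffs : (e f : LinExpr (List Letter)) → (∀ k u → coeffᴸ e k u ≡ coeffᴸ f k u) → ⟦ e ⟧ᴸ ≋ ⟦ f ⟧ᴸ
≋-byCoeffs e f p = ⟨ (λ k u → trans (coeff-⟦⟧ᴸ e k u) (trans (p k u) (sym (coeff-⟦⟧ᴸ f k u)))) ⟩

mapᴸ : {A : Set} → (FM A → 𝔥) → LinExpr A → LinExpr (List Letter)
mapᴸ g (atom x) = atom (g x)
mapᴸ g (e ⊞ f)  = mapᴸ g e ⊞ mapᴸ g f
mapᴸ g (q ⊛ e)  = q ⊛ mapᴸ g e
mapᴸ g (ħ⊛ e)   = ħ⊛ (mapᴸ g e)

linear-⟦⟧ᴸ : {A : Set} {g : FM A → 𝔥} → IsLinear g → ∀ e → g ⟦ e ⟧ᴸ ≋ ⟦ mapᴸ g e ⟧ᴸ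
linear-⟦⟧ᴸ G (atom x) = ≋-refl
linear-⟦⟧ᴸ G (e ⊞ f)  = ≋-trans (linear-⊕ G ⟦ e ⟧ᴸ ⟦ f ⟧ᴸ) (⊕-cong (linear-⟦⟧ᴸ G e) (linear-⟦⟧ᴸ G f))
linear-⟦⟧ᴸ G (q ⊛ e)  = ≋-trans (linear-scal G q (+ 0) ⟦ e ⟧ᴸ) (scal-cong q (+ 0) (linear-⟦⟧ᴸ G e))
linear-⟦⟧ᴸ G (ħ⊛ e)   = ≋-trans (linear-scal G 1ℚ (+ 1) ⟦ e ⟧ᴸ) (scal-cong 1ℚ (+ 1) (linear-⟦⟧ᴸ G e))

infix 4 _∼_
infixl 6 _⊞∼_
data _∼_ : LinExpr (List Letter) → LinExpr (List Letter) → Set where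
  atom∼ : {x : 𝔥} {e : LinExpr (List Letter)} → x ≋ ⟦ e ⟧ᴸ → atom x ∼ e
  _⊞∼_  : {e e' f f' : LinExpr (List Letter)} → e ∼ e' → f ∼ f' → e ⊞ f ∼ e' ⊞ f'
  ⊛∼    : ∀ q {e e'} → e ∼ e' → q ⊛ e ∼ q ⊛ e'
  ħ⊛∼   : {e e' : LinExpr (List Letter)} → e ∼ e' → ħ⊛ e ∼ ħ⊛ e'

∼⇒≋ : {e f : LinExpr (List Letter)} → e ∼ f → ⟦ e ⟧ᴸ ≋ ⟦ f ⟧ᴸ
∼⇒≋ (atom∼ p)  = p
∼⇒≋ (p ⊞∼ q)  = ⊕-cong (∼⇒≋ p) (∼⇒≋ q)
∼⇒≋ (⊛∼ q p)  = scal-cong q (+ 0) (∼⇒≋ p)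
∼⇒≋ (ħ⊛∼ p)   = scal-cong 1ℚ (+ 1) (∼⇒≋ p)

atom≋ : {x y : 𝔥} → x ≋ y → atom x ∼ atom y
atom≋ = atom∼

∼-refl : {x : 𝔥} → atom x ∼ atom x
∼-refl = atom∼ ≋-refl

·-linearˡ : (y : 𝔥) → IsLinear (λ x → x · y)
·-linearˡ y = bilinˡ-isLinear (λ u v → ⟦ u ++ v ⟧) y

·-linearʳ : (x : 𝔥) → IsLinear (λ y → x · y)
·-linearʳ x = bilinʳ-isLinear (λ u v → ⟦ u ++ v ⟧) x

·-congʳ : {x x' : 𝔥} (y : 𝔥) → x ≋ x' → x · y ≋ x' · y
·-congʳ y = linear-cong (·-linearˡ y)

·-congˡ : (x : 𝔥) {y y' : 𝔥} → y ≋ y' → x · y ≋ x · y'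
·-congˡ x = linear-cong (·-linearʳ x)

·-cong : {x x' y y' : 𝔥} → x ≋ x' → y ≋ y' → x · y ≋ x' · y'
·-cong {x} {x'} {y} {y'} x≋x' y≋y' = ≋-trans (·-congʳ y x≋x') (·-congˡ x' y≋y')

⟦⟧·⟦⟧ : (u v : List Letter) → ⟦ u ⟧ · ⟦ v ⟧ ≋ ⟦ u ++ v ⟧
⟦⟧·⟦⟧ = bilin-⟦⟧ (λ u v → ⟦ u ++ v ⟧)

id-isLinear : IsLinear (λ (x : 𝔥) → x)
id-isLinear = record
  { linear-[] = ≋-refl
  ; linear-∷  = λ t x → ⊕-cong {x = t ∷ []}
      (≡⇒≋ (cong₂ (λ a i → term a i (base t) ∷ [])
                  (sym (ℚP.*-identityʳ (coef t))) (sym (ℤP.+-identityʳ (hexp t)))))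
      (≋-refl {x}) }

·-assoc : (x y z : 𝔥) → (x · y) · z ≋ x · (y · z)
·-assoc x y z =
  linear-ext (∘-isLinear (·-linearˡ z) (·-linearˡ y)) (·-linearˡ (y · z)) (λ u →
  linear-ext (∘-isLinear (·-linearˡ z) (·-linearʳ ⟦ u ⟧)) (∘-isLinear (·-linearʳ ⟦ u ⟧) (·-linearˡ z)) (λ v →
  linear-ext (·-linearʳ (⟦ u ⟧ · ⟦ v ⟧)) (∘-isLinear (·-linearʳ ⟦ u ⟧) (·-linearʳ ⟦ v ⟧)) (λ w →
    let open ≋-Reasoning in begin
    (⟦ u ⟧ · ⟦ v ⟧) · ⟦ w ⟧  ≈⟨ ·-congʳ ⟦ w ⟧ (⟦⟧·⟦⟧ u v) ⟩
    ⟦ u ++ v ⟧ · ⟦ w ⟧       ≈⟨ ⟦⟧·⟦⟧ (u ++ v) w ⟩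
    ⟦ (u ++ v) ++ w ⟧        ≡⟨ cong ⟦_⟧ (ListP.++-assoc u v w) ⟩
    ⟦ u ++ v ++ w ⟧          ≈⟨ ⟦⟧·⟦⟧ u (v ++ w) ⟨
    ⟦ u ⟧ · ⟦ v ++ w ⟧       ≈⟨ ·-congˡ ⟦ u ⟧ (⟦⟧·⟦⟧ v w) ⟨
    ⟦ u ⟧ · (⟦ v ⟧ · ⟦ w ⟧)  ∎) z) y) x

·-identityˡ : (x : 𝔥) → 1A · x ≋ x
·-identityˡ = linear-ext (·-linearʳ 1A) id-isLinear (⟦⟧·⟦⟧ [])

·-identityʳ : (x : 𝔥) → x · 1A ≋ x
·-identityʳ = linear-ext (·-linearˡ 1A) id-isLinear (λ v →
  ≋-trans (⟦⟧·⟦⟧ v []) (≡⇒≋ (cong ⟦_⟧ (ListP.++-identityʳ v))))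

pow-+ : (x : 𝔥) (i j : ℕ) → pow x i · pow x j ≋ pow x (i + j)
pow-+ x zero    j = ·-identityˡ (pow x j)
pow-+ x (suc i) j = ≋-trans (·-assoc x (pow x i) (pow x j)) (·-congˡ x (pow-+ x i j))

pow-comm : (x : 𝔥) (i j : ℕ) → pow x i · pow x j ≋ pow x j · pow x i
pow-comm x i j = ≋-trans (pow-+ x i j) (≋-trans (≡⇒≋ (cong (pow x) (ℕP.+-comm i j))) (≋-sym (pow-+ x j i)))

𝐚-pow-comm : (n : ℕ) → 𝐚 · pow 𝐚 n ≋ pow 𝐚 n · 𝐚
𝐚-pow-comm n = ≋-trans (·-congʳ (pow 𝐚 n) (≋-sym (·-identityʳ 𝐚)))
  (≋-trans (pow-comm 𝐚 1 n) (·-congˡ (pow 𝐚 n) (·-identityʳ 𝐚)))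

-- For each l, ιgen l reduces to stem l · 𝐛, and stem l is a polynomial in 𝐚 and ħ.
stem : N̂ → 𝔥
stem 1̄      = 𝐚
stem (ix j) = pow 𝐚 j · (𝐚 ⊕ ħ· 1A)

stem-pow-comm : (l : N̂) (n : ℕ) → stem l · pow 𝐚 n ≋ pow 𝐚 n · stem l
stem-pow-comm 1̄      n = 𝐚-pow-comm n
stem-pow-comm (ix j) n = let open ≋-Reasoning in begin
  (pow 𝐚 j · 𝐚+ħ) · pow 𝐚 n  ≈⟨ ·-assoc (pow 𝐚 j) 𝐚+ħ (pow 𝐚 n) ⟩
  pow 𝐚 j · (𝐚+ħ · pow 𝐚 n)  ≈⟨ ·-congˡ (pow 𝐚 j) 𝐚+ħ-pow-comm ⟩
  pow 𝐚 j · (pow 𝐚 n · 𝐚+ħ)  ≈⟨ ·-assoc (pow 𝐚 j) (pow 𝐚 n) 𝐚+ħ ⟨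
  (pow 𝐚 j · pow 𝐚 n) · 𝐚+ħ  ≈⟨ ·-congʳ 𝐚+ħ (pow-comm 𝐚 j n) ⟩
  (pow 𝐚 n · pow 𝐚 j) · 𝐚+ħ  ≈⟨ ·-assoc (pow 𝐚 n) (pow 𝐚 j) 𝐚+ħ ⟩
  pow 𝐚 n · (pow 𝐚 j · 𝐚+ħ)  ∎
  where
  𝐚+ħ : 𝔥
  𝐚+ħ = 𝐚 ⊕ ħ· 1A
  𝐚+ħ-pow-comm : 𝐚+ħ · pow 𝐚 n ≋ pow 𝐚 n · 𝐚+ħ
  𝐚+ħ-pow-comm =
    ≋-trans (linear-⟦⟧ᴸ (·-linearˡ (pow 𝐚 n)) (atom 𝐚 ⊞ ħ⊛ (atom 1A)))
    (≋-trans (∼⇒≋ (atom≋ (𝐚-pow-comm n)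
                ⊞∼ ħ⊛∼ (atom≋ (≋-trans (·-identityˡ (pow 𝐚 n)) (≋-sym (·-identityʳ (pow 𝐚 n)))))))
    (≋-sym (linear-⟦⟧ᴸ (·-linearʳ (pow 𝐚 n)) (atom 𝐚 ⊞ ħ⊛ (atom 1A)))))

module Derivation (m : ℕ) where

  δ-isLinear : IsLinear (δ m)
  δ-isLinear = lin-isLinear (δword m)

  δword-++ : ∀ u v → δword m (u ++ v) ≋ δword m u · ⟦ v ⟧ ⊕ ⟦ u ⟧ · δword m v
  δword-++ []      v = ≋-sym (·-identityˡ (δword m v))
  δword-++ (x ∷ u) v = let open ≋-Reasoning in begin
    δgen m x · ⟦ u ++ v ⟧ ⊕ gen x · δword m (u ++ v)
      ≈⟨ ⊕-cong (·-congˡ (δgen m x) (≋-sym (⟦⟧·⟦⟧ u v)))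
                (≋-trans (·-congˡ (gen x) (δword-++ u v))
                         (linear-⊕ (·-linearʳ (gen x)) (δword m u · ⟦ v ⟧) (⟦ u ⟧ · δword m v))) ⟩
    δgen m x · (⟦ u ⟧ · ⟦ v ⟧) ⊕ (gen x · (δword m u · ⟦ v ⟧) ⊕ gen x · (⟦ u ⟧ · δword m v))
      ≈⟨ ⊕-cong (≋-sym (·-assoc (δgen m x) ⟦ u ⟧ ⟦ v ⟧))
                (⊕-cong (≋-sym (·-assoc (gen x) (δword m u) ⟦ v ⟧)) (≋-sym (·-assoc (gen x) ⟦ u ⟧ (δword m v)))) ⟩
    (δgen m x · ⟦ u ⟧) · ⟦ v ⟧ ⊕ ((gen x · δword m u) · ⟦ v ⟧ ⊕ (gen x · ⟦ u ⟧) · δword m v)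
      ≈⟨ ⊕-assoc ((δgen m x · ⟦ u ⟧) · ⟦ v ⟧) _ _ ⟨
    ((δgen m x · ⟦ u ⟧) · ⟦ v ⟧ ⊕ (gen x · δword m u) · ⟦ v ⟧) ⊕ (gen x · ⟦ u ⟧) · δword m v
      ≈⟨ ⊕-cong (≋-sym (linear-⊕ (·-linearˡ ⟦ v ⟧) (δgen m x · ⟦ u ⟧) (gen x · δword m u)))
                (·-congʳ (δword m v) (⟦⟧·⟦⟧ (x ∷ []) u)) ⟩
    (δgen m x · ⟦ u ⟧ ⊕ gen x · δword m u) · ⟦ v ⟧ ⊕ ⟦ x ∷ u ⟧ · δword m v ∎

  leibniz : (x y : 𝔥) → δ m (x · y) ≋ δ m x · y ⊕ x · δ m y
  leibniz x y =
    linear-ext (∘-isLinear δ-isLinear (·-linearˡ y))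
               (⊕-isLinear (∘-isLinear (·-linearˡ y) δ-isLinear) (·-linearˡ (δ m y))) (λ u →
    linear-ext (∘-isLinear δ-isLinear (·-linearʳ ⟦ u ⟧))
               (⊕-isLinear (·-linearʳ (δ m ⟦ u ⟧)) (∘-isLinear (·-linearʳ ⟦ u ⟧) δ-isLinear)) (λ v →
      let open ≋-Reasoning in begin
      δ m (⟦ u ⟧ · ⟦ v ⟧)                  ≈⟨ linear-cong δ-isLinear (⟦⟧·⟦⟧ u v) ⟩
      δ m ⟦ u ++ v ⟧                       ≈⟨ lin-⟦⟧ (δword m) (u ++ v) ⟩
      δword m (u ++ v)                     ≈⟨ δword-++ u v ⟩
      δword m u · ⟦ v ⟧ ⊕ ⟦ u ⟧ · δword m v
        ≈⟨ ⊕-cong (·-congʳ ⟦ v ⟧ (≋-sym (lin-⟦⟧ (δword m) u))) (·-congˡ ⟦ u ⟧ (≋-sym (lin-⟦⟧ (δword m) v))) ⟩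
      δ m ⟦ u ⟧ · ⟦ v ⟧ ⊕ ⟦ u ⟧ · δ m ⟦ v ⟧ ∎) y) x

  leibniz-constˡ : {x : 𝔥} → δ m x ≋ 0M → ∀ y → δ m (x · y) ≋ x · δ m y
  leibniz-constˡ {x} δx≋0 y = ≋-trans (leibniz x y) (⊕-cong (·-congʳ y δx≋0) (≋-refl {x · δ m y}))

  δ-1 : δ m 1A ≋ 0M
  δ-1 = lin-⟦⟧ (δword m) []

  δ-𝐚 : δ m 𝐚 ≋ 0M
  δ-𝐚 = ≋-trans (lin-⟦⟧ (δword m) (ᵃ ∷ [])) (linear-[] (·-linearʳ (gen ᵃ)))

  δ-𝐛 : δ m 𝐛 ≋ δgen m ᵇ
  δ-𝐛 = ≋-trans (lin-⟦⟧ (δword m) (ᵇ ∷ []))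
    (≋-trans (⊕-cong (·-identityʳ (δgen m ᵇ)) (linear-[] (·-linearʳ (gen ᵇ)))) (⊕-identityʳ _))

  δ-pow𝐚 : ∀ n → δ m (pow 𝐚 n) ≋ 0M
  δ-pow𝐚 zero    = δ-1
  δ-pow𝐚 (suc n) = ≋-trans (leibniz-constˡ {𝐚} δ-𝐚 (pow 𝐚 n))
    (≋-trans (·-congˡ 𝐚 (δ-pow𝐚 n)) (linear-[] (·-linearʳ 𝐚)))

  δ-stem : ∀ l → δ m (stem l) ≋ 0M
  δ-stem 1̄      = δ-𝐚
  δ-stem (ix j) = ≋-trans (leibniz-constˡ {pow 𝐚 j} (δ-pow𝐚 j) (𝐚 ⊕ ħ· 1A))
    (≋-trans (·-congˡ (pow 𝐚 j) δ-𝐚+ħ) (linear-[] (·-linearʳ (pow 𝐚 j))))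
    where
    δ-𝐚+ħ : δ m (𝐚 ⊕ ħ· 1A) ≋ 0M
    δ-𝐚+ħ = ≋-trans (linear-⊕ δ-isLinear 𝐚 (ħ· 1A))
      (⊕-cong δ-𝐚 (≋-trans (linear-scal δ-isLinear 1ℚ (+ 1) 1A) (scal-cong 1ℚ (+ 1) δ-1)))

ι-isLinear : IsLinear ι
ι-isLinear = lin-isLinear ιword

ι-⟦⟧ : (v : List N̂) → ι ⟦ v ⟧ ≋ ιword v
ι-⟦⟧ = lin-⟦⟧ ιword

ι-e : (k : N̂) → ι (e k) ≋ ιgen k
ι-e k = ≋-trans (ι-⟦⟧ (k ∷ [])) (·-identityʳ (ιgen k))

ιword-++ : (u v : List N̂) → ιword (u ++ v) ≋ ιword u · ιword v
ιword-++ []      v = ≋-sym (·-identityˡ (ιword v))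
ιword-++ (k ∷ u) v = ≋-trans (·-congˡ (ιgen k) (ιword-++ u v)) (≋-sym (·-assoc (ιgen k) (ιword u) (ιword v)))

ι-· : (X Y : H1) → ι (X · Y) ≋ ι X · ι Y
ι-· X Y =
  linear-ext (lin-bilinˡ-isLinear ιword concat Y) (∘-isLinear (·-linearˡ (ι Y)) ι-isLinear) (λ u →
  linear-ext (lin-bilinʳ-isLinear ιword concat ⟦ u ⟧) (∘-isLinear (·-linearʳ (ι ⟦ u ⟧)) ι-isLinear) (λ v →
    let open ≋-Reasoning in begin
    ι (⟦ u ⟧ · ⟦ v ⟧)                         ≈⟨ lin-bilin ιword concat ⟦ u ⟧ ⟦ v ⟧ ⟩
    bilin (λ a b → ι (concat a b)) ⟦ u ⟧ ⟦ v ⟧  ≈⟨ bilin-⟦⟧ (λ a b → ι (concat a b)) u v ⟩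
    ι ⟦ u ++ v ⟧                              ≈⟨ ι-⟦⟧ (u ++ v) ⟩
    ιword (u ++ v)                            ≈⟨ ιword-++ u v ⟩
    ιword u · ιword v                         ≈⟨ ·-cong (ι-⟦⟧ u) (ι-⟦⟧ v) ⟨
    ι ⟦ u ⟧ · ι ⟦ v ⟧                         ∎) Y) X
  where
  concat : List N̂ → List N̂ → H1
  concat u v = ⟦ u ++ v ⟧

ι-e· : (k : N̂) (Y : H1) → ι (e k · Y) ≋ ιgen k · ι Y
ι-e· k Y = ≋-trans (ι-· (e k) Y) (·-congʳ (ι Y) (ι-e k))

ē : ℕ → 𝔥
ē m = pow 𝐚 (suc m) · 𝐛

ιgen-1̄ : ιgen 1̄ ≋ ē 0
ιgen-1̄ = ·-congʳ 𝐛 (≋-sym (·-identityʳ 𝐚))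

ιgen-ix : (j : ℕ) → ιgen (ix j) ≋ ⟦ atom (pow 𝐚 (suc j) · 𝐛) ⊞ ħ⊛ (atom (pow 𝐚 j · 𝐛)) ⟧ᴸ
ιgen-ix j = ≋-trans (·-congʳ 𝐛 stem-ix) (linear-⟦⟧ᴸ (·-linearˡ 𝐛) (atom (pow 𝐚 (suc j)) ⊞ ħ⊛ (atom (pow 𝐚 j))))
  where
  stem-ix : stem (ix j) ≋ ⟦ atom (pow 𝐚 (suc j)) ⊞ ħ⊛ (atom (pow 𝐚 j)) ⟧ᴸ
  stem-ix = ≋-trans (linear-⟦⟧ᴸ (·-linearʳ (pow 𝐚 j)) (atom 𝐚 ⊞ ħ⊛ (atom 1A)))
    (∼⇒≋ (atom≋ (≋-sym (𝐚-pow-comm j)) ⊞∼ ħ⊛∼ (atom≋ (·-identityʳ (pow 𝐚 j)))))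

pow-ιgen-1̄ : (i : ℕ) → pow 𝐚 i · ιgen 1̄ ≋ pow 𝐚 (suc i) · 𝐛
pow-ιgen-1̄ i = ≋-trans (≋-sym (·-assoc (pow 𝐚 i) 𝐚 𝐛)) (·-congʳ 𝐛 (≋-sym (𝐚-pow-comm i)))

pow-ιgen-ix : (i j : ℕ) → pow 𝐚 i · ιgen (ix j) ≋ ιgen (ix (i + j))
pow-ιgen-ix i j = ≋-trans (≋-sym (·-assoc (pow 𝐚 i) (stem (ix j)) 𝐛))
  (·-congʳ 𝐛 (≋-trans (≋-sym (·-assoc (pow 𝐚 i) (pow 𝐚 j) (𝐚 ⊕ ħ· 1A))) (·-congʳ (𝐚 ⊕ ħ· 1A) (pow-+ 𝐚 i j))))

ħ-cancel : {x y a b : 𝔥} → x ≋ a ⊕ ħ· b → y ≋ b → x ⊖ ħ· y ≋ a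
ħ-cancel {x} {y} {a} {b} x≋a+ħb y≋b = ≋-trans
  (∼⇒≋ {f = (atom a ⊞ ħ⊛ (atom b)) ⊞ -1ℚ ⊛ ħ⊛ (atom b)} (atom∼ x≋a+ħb ⊞∼ ⊛∼ -1ℚ (ħ⊛∼ (atom≋ y≋b))))
  (≋-byCoeffs ((atom a ⊞ ħ⊛ (atom b)) ⊞ -1ℚ ⊛ ħ⊛ (atom b)) (atom a)
    (λ k u → cancel (coeff a k u) (coeff b (k ℤ.- + 1) u)))
  where
  cancel : ∀ a b → (a ℚ.+ b) ℚ.+ -1ℚ ℚ.* b ≡ a
  cancel = solve-∀ ℚ-ring

ι-1̄∘q : (l : N̂) → ι (1̄ ∘q l) ≋ pow 𝐚 1 · ιgen l
ι-1̄∘q 1̄ = let open ≋-Reasoning in begin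
  ι (e (ix 1) ⊖ ħ· (e 1̄))             ≈⟨ linear-⟦⟧ᴸ ι-isLinear (atom (e (ix 1)) ⊞ -1ℚ ⊛ ħ⊛ (atom (e 1̄))) ⟩
  ι (e (ix 1)) ⊖ ħ· (ι (e 1̄))         ≈⟨ ħ-cancel (≋-trans (ι-e (ix 1)) (ιgen-ix 1)) (≋-trans (ι-e 1̄) ιgen-1̄) ⟩
  ē 1                                 ≈⟨ pow-ιgen-1̄ 1 ⟨
  pow 𝐚 1 · ιgen 1̄                    ∎
ι-1̄∘q (ix j) = ≋-trans (ι-e (ix (suc j))) (≋-sym (pow-ιgen-ix 1 j))

ι-ix∘q : (m : ℕ) (l : N̂) →
  ι (ix (suc m) ∘q l) ≋ ⟦ atom (pow 𝐚 (suc (suc m)) · ιgen l) ⊞ ħ⊛ (atom (pow 𝐚 (suc m) · ιgen l)) ⟧ᴸ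
ι-ix∘q m 1̄ = ≋-trans (ι-e (ix (suc (suc m)))) (≋-trans (ιgen-ix (suc (suc m)))
  (≋-sym (∼⇒≋ (atom≋ (pow-ιgen-1̄ (suc (suc m))) ⊞∼ ħ⊛∼ (atom≋ (pow-ιgen-1̄ (suc m)))))))
ι-ix∘q m (ix j) =
  ≋-trans (linear-⟦⟧ᴸ ι-isLinear (atom (e (ix (suc (suc m + j)))) ⊞ ħ⊛ (atom (e (ix (suc m + j))))))
  (≋-trans (∼⇒≋ (atom≋ (ι-e (ix (suc (suc m + j)))) ⊞∼ ħ⊛∼ (atom≋ (ι-e (ix (suc m + j))))))
  (≋-sym (∼⇒≋ (atom≋ (pow-ιgen-ix (suc (suc m)) j) ⊞∼ ħ⊛∼ (atom≋ (pow-ιgen-ix (suc m) j))))))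

ι*q : H1 → List N̂ → 𝔥
ι*q X w = ι (X *q ⟦ w ⟧)

ι*q-isLinear : (w : List N̂) → IsLinear (λ X → ι*q X w)
ι*q-isLinear w = lin-bilinˡ-isLinear ιword _*w_ ⟦ w ⟧

ι*q-e : (k : N̂) (w : List N̂) → ι*q (e k) w ≋ ι ((k ∷ []) *w w)
ι*q-e k w = ≋-trans (lin-bilin ιword _*w_ (e k) ⟦ w ⟧) (bilin-⟦⟧ (λ a b → ι (a *w b)) (k ∷ []) w)

ι*q-ebar-suc : (m : ℕ) (w : List N̂) →
  ι*q (ebar (suc m)) w ≋ ⟦ atom (ι*q (e (ix (suc m))) w) ⊞ -1ℚ ⊛ ħ⊛ (atom (ι*q (ebar m) w)) ⟧ᴸ
ι*q-ebar-suc m w = linear-⟦⟧ᴸ (ι*q-isLinear w) (atom (e (ix (suc m))) ⊞ -1ℚ ⊛ ħ⊛ (atom (ebar m)))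

ι-letter*w-∷ : (k l : N̂) (w : List N̂) →
  ι ((k ∷ []) *w (l ∷ w)) ≋ ιgen k · ιword (l ∷ w) ⊕ ιgen l · ι ((k ∷ []) *w w) ⊕ ι (k ∘q l) · ιword w
ι-letter*w-∷ k l w =
  ≋-trans (linear-⟦⟧ᴸ ι-isLinear (atom (k ◃ ⟦ l ∷ w ⟧) ⊞ atom (l ◃ ((k ∷ []) *w w)) ⊞ atom ((k ∘q l) · ⟦ w ⟧)))
  (∼⇒≋ (atom≋ (≋-trans (ι-e· k ⟦ l ∷ w ⟧) (·-congˡ (ιgen k) (ι-⟦⟧ (l ∷ w))))
     ⊞∼ atom≋ (ι-e· l ((k ∷ []) *w w))
     ⊞∼ atom≋ (≋-trans (ι-· (k ∘q l) ⟦ w ⟧) (·-congˡ (ι (k ∘q l)) (ι-⟦⟧ w)))))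

ι*q-ebar-[] : (m : ℕ) → ι*q (ebar m) [] ≋ ē m
ι*q-ebar-[] zero    = ≋-trans (ι*q-e 1̄ []) (≋-trans (ι-e 1̄) ιgen-1̄)
ι*q-ebar-[] (suc m) = ≋-trans (ι*q-ebar-suc m [])
  (ħ-cancel (≋-trans (ι*q-e (ix (suc m)) []) (≋-trans (ι-e (ix (suc m))) (ιgen-ix (suc m)))) (ι*q-ebar-[] m))

ι*q-ix-∷ : (m : ℕ) (l : N̂) (w : List N̂) → ι*q (e (ix (suc m))) (l ∷ w) ≋
  ⟦ ((atom (ē (suc m) · ιword (l ∷ w)) ⊞ ħ⊛ (atom (ē m · ιword (l ∷ w)))) ⊞ atom (ιgen l · ι*q (e (ix (suc m))) w))
    ⊞ (atom ((pow 𝐚 (suc (suc m)) · ιgen l) · ιword w) ⊞ ħ⊛ (atom ((pow 𝐚 (suc m) · ιgen l) · ιword w))) ⟧ᴸ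
ι*q-ix-∷ m l w = ≋-trans (ι*q-e (ix (suc m)) (l ∷ w)) (≋-trans (ι-letter*w-∷ (ix (suc m)) l w)
  (∼⇒≋ {f = ((atom (ē (suc m) · W) ⊞ ħ⊛ (atom (ē m · W))) ⊞ atom (g · ι*q (e (ix (suc m))) w))
            ⊞ (atom ((pow 𝐚 (suc (suc m)) · g) · V) ⊞ ħ⊛ (atom ((pow 𝐚 (suc m) · g) · V)))}
    (atom∼ (≋-trans (·-congʳ W (ιgen-ix (suc m))) (linear-⟦⟧ᴸ (·-linearˡ W) (atom (ē (suc m)) ⊞ ħ⊛ (atom (ē m)))))
     ⊞∼ atom≋ (·-congˡ g (≋-sym (ι*q-e (ix (suc m)) w)))
     ⊞∼ atom∼ (≋-trans (·-congʳ V (ι-ix∘q m l))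
                (linear-⟦⟧ᴸ (·-linearˡ V) (atom (pow 𝐚 (suc (suc m)) · g) ⊞ ħ⊛ (atom (pow 𝐚 (suc m) · g))))))))
  where
  g W V : 𝔥
  g = ιgen l
  W = ιword (l ∷ w)
  V = ιword w

-- e_{\bar n} is not a letter, but in the image it obeys the stuffle recursion of a letter
-- whose ∘q acts as left multiplication by 𝐚^n; induction on n via e_{\bar{n+1}} = e_{n+1} - ħ e_{\bar n}.
ι*q-ebar-∷ : (m : ℕ) (l : N̂) (w : List N̂) → ι*q (ebar m) (l ∷ w) ≋
  ⟦ atom (ē m · ιword (l ∷ w)) ⊞ atom (ιgen l · ι*q (ebar m) w) ⊞ atom ((pow 𝐚 (suc m) · ιgen l) · ιword w) ⟧ᴸ
ι*q-ebar-∷ zero l w = ≋-trans (ι*q-e 1̄ (l ∷ w)) (≋-trans (ι-letter*w-∷ 1̄ l w)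
  (∼⇒≋ (atom≋ (·-congʳ (ιword (l ∷ w)) ιgen-1̄)
     ⊞∼ atom≋ (·-congˡ (ιgen l) (≋-sym (ι*q-e 1̄ w)))
     ⊞∼ atom≋ (·-congʳ (ιword w) (ι-1̄∘q l)))))
ι*q-ebar-∷ (suc m) l w = let open ≋-Reasoning in begin
  ι*q (ebar (suc m)) (l ∷ w)
    ≈⟨ ι*q-ebar-suc m (l ∷ w) ⟩
  ι*q (e (ix (suc m))) (l ∷ w) ⊖ ħ· (ι*q (ebar m) (l ∷ w))
    ≈⟨ ∼⇒≋ {f = expanded} (atom∼ (ι*q-ix-∷ m l w) ⊞∼ ⊛∼ -1ℚ (ħ⊛∼ (atom∼ (ι*q-ebar-∷ m l w)))) ⟩
  ⟦ expanded ⟧ᴸ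
    ≈⟨ ≋-byCoeffs expanded regrouped (λ k u → regroup
         (coeff a₁ k u) (coeff a₂ (k ℤ.- + 1) u) (coeff a₃ k u)
         (coeff a₄ (k ℤ.- + 1) u) (coeff a₅ k u) (coeff a₆ (k ℤ.- + 1) u)) ⟩
  ⟦ regrouped ⟧ᴸ
    ≈⟨ ∼⇒≋ {f = regrouped} (∼-refl ⊞∼ atom∼ g·ι*q-ebar-suc ⊞∼ ∼-refl) ⟨
  ⟦ atom a₁ ⊞ atom (g · ι*q (ebar (suc m)) w) ⊞ atom a₅ ⟧ᴸ ∎
  where
  g a₁ a₂ a₃ a₄ a₅ a₆ : 𝔥
  g = ιgen l
  a₁ = ē (suc m) · ιword (l ∷ w)
  a₂ = ē m · ιword (l ∷ w)
  a₃ = g · ι*q (e (ix (suc m))) w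
  a₄ = g · ι*q (ebar m) w
  a₅ = (pow 𝐚 (suc (suc m)) · g) · ιword w
  a₆ = (pow 𝐚 (suc m) · g) · ιword w
  expanded regrouped : LinExpr (List Letter)
  expanded = (((atom a₁ ⊞ ħ⊛ (atom a₂)) ⊞ atom a₃) ⊞ (atom a₅ ⊞ ħ⊛ (atom a₆)))
             ⊞ -1ℚ ⊛ ħ⊛ (atom a₂ ⊞ atom a₄ ⊞ atom a₆)
  regrouped = atom a₁ ⊞ (atom a₃ ⊞ -1ℚ ⊛ ħ⊛ (atom a₄)) ⊞ atom a₅
  regroup : ∀ a₁ a₂ a₃ a₄ a₅ a₆ →
    (((a₁ ℚ.+ a₂) ℚ.+ a₃) ℚ.+ (a₅ ℚ.+ a₆)) ℚ.+ -1ℚ ℚ.* ((a₂ ℚ.+ a₄) ℚ.+ a₆) ≡ (a₁ ℚ.+ (a₃ ℚ.+ -1ℚ ℚ.* a₄)) ℚ.+ a₅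
  regroup = solve-∀ ℚ-ring
  g·ι*q-ebar-suc : g · ι*q (ebar (suc m)) w ≋ ⟦ atom a₃ ⊞ -1ℚ ⊛ ħ⊛ (atom a₄) ⟧ᴸ
  g·ι*q-ebar-suc = ≋-trans (·-congˡ g (ι*q-ebar-suc m w))
    (linear-⟦⟧ᴸ (·-linearʳ g) (atom (ι*q (e (ix (suc m))) w) ⊞ -1ℚ ⊛ ħ⊛ (atom (ι*q (ebar m) w))))

δ-stem·𝐛 : (m : ℕ) (l : N̂) →
  δ m (stem l · 𝐛) ≋ ⟦ c m ⊛ (atom (stem l · 𝐛 · ē m) ⊞ atom (pow 𝐚 (suc m) · (stem l · 𝐛))) ⟧ᴸ
δ-stem·𝐛 m l = let open ≋-Reasoning in begin
  δ m (s · 𝐛)                               ≈⟨ leibniz-constˡ {s} (δ-stem l) 𝐛 ⟩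
  s · δ m 𝐛                                 ≈⟨ ·-congˡ s δ-𝐛 ⟩
  s · (c m ·ℚ ((𝐛 ⊕ 1A) · pow 𝐚 (suc m) · 𝐛))
    ≈⟨ linear-⟦⟧ᴸ (·-linearʳ s) (c m ⊛ atom ((𝐛 ⊕ 1A) · pow 𝐚 (suc m) · 𝐛)) ⟩
  c m ·ℚ (s · ((𝐛 ⊕ 1A) · pow 𝐚 (suc m) · 𝐛))
    ≈⟨ ∼⇒≋ {f = c m ⊛ (atom (s · 𝐛 · ē m) ⊞ atom (pow 𝐚 (suc m) · (s · 𝐛)))} (⊛∼ (c m) (atom∼ expand)) ⟩
  ⟦ c m ⊛ (atom (s · 𝐛 · ē m) ⊞ atom (pow 𝐚 (suc m) · (s · 𝐛))) ⟧ᴸ ∎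
  where
  open Derivation m
  s : 𝔥
  s = stem l
  expand : s · ((𝐛 ⊕ 1A) · pow 𝐚 (suc m) · 𝐛) ≋ s · 𝐛 · ē m ⊕ pow 𝐚 (suc m) · (s · 𝐛)
  expand = let open ≋-Reasoning in begin
    s · ((𝐛 ⊕ 1A) · pow 𝐚 (suc m) · 𝐛)  ≈⟨ ·-congˡ s (·-assoc (𝐛 ⊕ 1A) (pow 𝐚 (suc m)) 𝐛) ⟩
    s · ((𝐛 ⊕ 1A) · ē m)                ≈⟨ ·-congˡ s (linear-⊕ (·-linearˡ (ē m)) 𝐛 1A) ⟩
    s · (𝐛 · ē m ⊕ 1A · ē m)            ≈⟨ linear-⊕ (·-linearʳ s) (𝐛 · ē m) (1A · ē m) ⟩
    s · (𝐛 · ē m) ⊕ s · (1A · ē m)      ≈⟨ ⊕-cong (≋-sym (·-assoc s 𝐛 (ē m))) (·-congˡ s (·-identityˡ (ē m))) ⟩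
    s · 𝐛 · ē m ⊕ s · (pow 𝐚 (suc m) · 𝐛)
      ≈⟨ ⊕-cong ≋-refl (≋-trans (≋-sym (·-assoc s (pow 𝐚 (suc m)) 𝐛)) (·-congʳ 𝐛 (stem-pow-comm l (suc m)))) ⟩
    s · 𝐛 · ē m ⊕ pow 𝐚 (suc m) · s · 𝐛  ≈⟨ ⊕-cong ≋-refl (·-assoc (pow 𝐚 (suc m)) s 𝐛) ⟩
    s · 𝐛 · ē m ⊕ pow 𝐚 (suc m) · (s · 𝐛) ∎

δ-ιgen : (m : ℕ) (l : N̂) →
  δ m (ιgen l) ≋ ⟦ c m ⊛ (atom (ιgen l · ē m) ⊞ atom (pow 𝐚 (suc m) · ιgen l)) ⟧ᴸ
δ-ιgen m 1̄      = δ-stem·𝐛 m 1̄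
δ-ιgen m (ix j) = δ-stem·𝐛 m (ix j)

-- Induction on w, matching Leibniz's rule against the stuffle recursion ι*q-ebar-∷.
δ-ιword : (m : ℕ) (w : List N̂) →
  δ m (ιword w) ≋ ⟦ c m ⊛ (atom (ι*q (ebar m) w) ⊞ -1ℚ ⊛ atom (ē m · ιword w)) ⟧ᴸ
δ-ιword m [] = ≋-trans (Derivation.δ-1 m) (≋-sym (≋-trans
  (∼⇒≋ {f = c m ⊛ (atom (ē m) ⊞ -1ℚ ⊛ atom (ē m))}
    (⊛∼ (c m) (atom≋ (ι*q-ebar-[] m) ⊞∼ ⊛∼ -1ℚ (atom≋ (·-identityʳ (ē m))))))
  (≋-byCoeffs (c m ⊛ (atom (ē m) ⊞ -1ℚ ⊛ atom (ē m))) (atom 0M) (λ k u → vanish (c m) (coeff (ē m) k u)))))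
  where
  vanish : ∀ c a → c ℚ.* (a ℚ.+ -1ℚ ℚ.* a) ≡ 0ℚ
  vanish = solve-∀ ℚ-ring
δ-ιword m (l ∷ w) = let open ≋-Reasoning in begin
  δ m (g · V)                   ≈⟨ leibniz g V ⟩
  δ m g · V ⊕ g · δ m V         ≈⟨ ∼⇒≋ {f = expanded} (atom∼ δg·V ⊞∼ atom∼ g·δV) ⟩
  ⟦ expanded ⟧ᴸ                 ≈⟨ ≋-byCoeffs expanded regrouped (λ k u →
                                     regroup (c m) (coeff x₁ k u) (coeff x₂ k u) (coeff x₃ k u) (coeff y k u)) ⟩
  ⟦ regrouped ⟧ᴸ                ≈⟨ ∼⇒≋ {f = regrouped} (⊛∼ (c m) (atom∼ (ι*q-ebar-∷ m l w) ⊞∼ ⊛∼ -1ℚ ∼-refl)) ⟨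
  ⟦ c m ⊛ (atom (ι*q (ebar m) (l ∷ w)) ⊞ -1ℚ ⊛ atom (ē m · (g · V))) ⟧ᴸ ∎
  where
  open Derivation m
  g V x₁ x₂ x₃ y : 𝔥
  g = ιgen l
  V = ιword w
  x₁ = g · (ē m · V)
  x₂ = (pow 𝐚 (suc m) · g) · V
  x₃ = g · ι*q (ebar m) w
  y = ē m · (g · V)
  expanded regrouped : LinExpr (List Letter)
  expanded = c m ⊛ (atom x₁ ⊞ atom x₂) ⊞ c m ⊛ (atom x₃ ⊞ -1ℚ ⊛ atom x₁)
  regrouped = c m ⊛ (atom y ⊞ atom x₃ ⊞ atom x₂ ⊞ -1ℚ ⊛ atom y)
  regroup : ∀ c x₁ x₂ x₃ y →
    c ℚ.* (x₁ ℚ.+ x₂) ℚ.+ c ℚ.* (x₃ ℚ.+ -1ℚ ℚ.* x₁) ≡ c ℚ.* (((y ℚ.+ x₃) ℚ.+ x₂) ℚ.+ -1ℚ ℚ.* y)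
  regroup = solve-∀ ℚ-ring
  δg·V : δ m g · V ≋ ⟦ c m ⊛ (atom x₁ ⊞ atom x₂) ⟧ᴸ
  δg·V = ≋-trans (·-congʳ V (δ-ιgen m l))
    (≋-trans (linear-⟦⟧ᴸ (·-linearˡ V) (c m ⊛ (atom (g · ē m) ⊞ atom (pow 𝐚 (suc m) · g))))
      (∼⇒≋ (⊛∼ (c m) (atom≋ (·-assoc g (ē m) V) ⊞∼ ∼-refl))))
  g·δV : g · δ m V ≋ ⟦ c m ⊛ (atom x₃ ⊞ -1ℚ ⊛ atom x₁) ⟧ᴸ
  g·δV = ≋-trans (·-congˡ g (δ-ιword m w))
    (linear-⟦⟧ᴸ (·-linearʳ g) (c m ⊛ (atom (ι*q (ebar m) w) ⊞ -1ℚ ⊛ atom (ē m · V))))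

δ-ι : (m : ℕ) (w : H1) → δ m (ι w) ≋ ι ((c m ·ℚ ebar m) *q w) ⊖ (c m ·ℚ ē m) · ι w
δ-ι m w = ≋-trans (linear-lin (Derivation.δ-isLinear m) ιword w)
  (≋-trans (lin-pointwise on-words w) (≋-sym (linear-≋-lin rhs-isLinear w)))
  where
  rhs : H1 → 𝔥
  rhs y = ι ((c m ·ℚ ebar m) *q y) ⊖ (c m ·ℚ ē m) · ι y
  rhs-isLinear : IsLinear rhs
  rhs-isLinear = ⊕-isLinear (lin-bilinʳ-isLinear ιword _*w_ (c m ·ℚ ebar m))
    (∘-isLinear (scal-isLinear -1ℚ (+ 0)) (∘-isLinear (·-linearʳ (c m ·ℚ ē m)) ι-isLinear))
  on-words : ∀ v → δ m (ιword v) ≋ rhs ⟦ v ⟧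
  on-words v = let open ≋-Reasoning in begin
    δ m (ιword v)
      ≈⟨ δ-ιword m v ⟩
    ⟦ c m ⊛ (atom (ι*q (ebar m) v) ⊞ -1ℚ ⊛ atom (ē m · ιword v)) ⟧ᴸ
      ≈⟨ ≋-byCoeffs (c m ⊛ (atom (ι*q (ebar m) v) ⊞ -1ℚ ⊛ atom (ē m · ιword v))) distributed
           (λ k u → distribute (c m) (coeff (ι*q (ebar m) v) k u) (coeff (ē m · ιword v) k u)) ⟩
    ⟦ distributed ⟧ᴸ
      ≈⟨ ∼⇒≋ {f = distributed} (atom∼ (linear-scal (ι*q-isLinear v) (c m) (+ 0) (ebar m)) ⊞∼ ⊛∼ -1ℚ (atom∼
           (≋-trans (·-congˡ (c m ·ℚ ē m) (ι-⟦⟧ v)) (linear-scal (·-linearˡ (ιword v)) (c m) (+ 0) (ē m))))) ⟨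
    rhs ⟦ v ⟧ ∎
    where
    distributed : LinExpr (List Letter)
    distributed = c m ⊛ atom (ι*q (ebar m) v) ⊞ -1ℚ ⊛ c m ⊛ atom (ē m · ιword v)
    distribute : ∀ c t a → c ℚ.* (t ℚ.+ -1ℚ ℚ.* a) ≡ c ℚ.* t ℚ.+ -1ℚ ℚ.* (c ℚ.* a)
    distribute = solve-∀ ℚ-ring

cauchy-cst : ∀ {A B C : Set} (f : A → B → FM C) (g : ℕ → FM A) (x : FM B) n →
  cauchy (bilin f) g (cst x) n ≡ bilin f (g n) x
cauchy-cst f g x n = trans (ΣM-last (λ i → bilin f (g i) (cst x (n ∸ i))) (λ i → i) n
    (λ i i<n → trans (cong (bilin f (g i)) (cst-∸ i n i<n)) (bilin-[] (g i))))
  (cong (λ i → bilin f (g n) (cst x i)) (ℕP.n∸n≡0 n))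
  where
  bilin-[] : ∀ y → bilin f y [] ≡ []
  bilin-[] []      = refl
  bilin-[] (s ∷ y) = bilin-[] y
  cst-∸ : ∀ i n → i < n → cst x (n ∸ i) ≡ []
  cst-∸ zero    (suc n) _         = refl
  cst-∸ (suc i) (suc n) (s≤s i<n) = cst-∸ i n i<n
  ΣM-last : ∀ {X : Set} (G : ℕ → FM X) (h : ℕ → ℕ) n → (∀ i → i < n → G (h i) ≡ []) →
    ΣM (map G (applyUpTo h (suc n))) ≡ G (h n)
  ΣM-last G h zero    _       = ListP.++-identityʳ (G (h 0))
  ΣM-last G h (suc n) earlier =
    trans (cong (_++ ΣM (map G (applyUpTo (λ i → h (suc i)) (suc n)))) (earlier 0 (s≤s z≤n)))
    (ΣM-last G (λ i → h (suc i)) n (λ i i<n → earlier (suc i) (s≤s i<n)))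

lemma3p3 : (w : H1) →
    D*X (ι w) ≈ₚ (PSmap ι (cauchy _*q_ φ̂ (cst w)) ⊖ₚ cauchy _·_ φ (cst (ι w)))
lemma3p3 w zero    k u = refl
lemma3p3 w (suc m) k u = trans (coeff-≡ (δ-ι m w) k u)
  (cong₂ (λ X y → coeff (ι X ⊖ y) k u)
    (sym (cauchy-cst _*w_ φ̂ w (suc m)))
    (sym (cauchy-cst (λ u v → ⟦ u ++ v ⟧) φ (ι w) (suc m))))
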